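{- Let $l:\mathbf{K}\to\mathbf{L}$ be a morphism of polarized graphs and $m:\mathbf{L}\to\mathbf{G}$ a matching of polarized graphs, regarded as an inclusion, so that $\mathbf{G}=(\mathbf{L}+\overline{\mathbf{L}})+_e\widetilde{\mathbf{L}}$ as in the decomposition described in the context, with $m$ the canonical inclusion. Assume moreover that $\vec{\widetilde L}^\star=\vec{\widetilde L}$ (every linking edge for $m$ is polarized). Let $l_1=l+\mathrm{id}_{|\overline{L}|}$ on nodes $|K|+|\overline L|$. Define $\widetilde{\mathbf{K}}$ by: $\vec{\widetilde K}^\star$ consists of one edge $(e,n_D,p_D):n_D\to p_D$ for each $n_D\in|K|^++|\overline L|^+$, each $p_D\in|K|^-+|\overline L|^-$ and each edge $e:l_1(n_D)\to l_1(p_D)$ in $\vec{\widetilde L}^\star$; and $\vec{\widetilde K}=\vec{\widetilde K}^\star$. Let $\widetilde{l}$ map $(e,n_D,p_D)$ to $e$. Put $\mathbf{D}=(\mathbf{K}+\overline{\mathbf{L}})+_e\widetilde{\mathbf{K}}$, $d:\mathbf{K}\to\mathbf{D}$ the canonical inclusion and $l_1=(l+\mathrm{id}_{\overline{\mathbf{L}}})+_e\widetilde{l}:\mathbf{D}\to\mathbf{G}$. Then $\mathbf{G}\xleftarrow{l_1}\mathbf{D}\xleftarrow{d}\mathbf{K}$ is the polarized pushback of $l$ and $m$. In particular, $\vec{\widetilde K}(n_D,p_D)=\vec{\widetilde K}^\star(n_D,p_D)\cong\vec{\widetilde L}^\star(l_1(n_D),l_1(p_D))$ for all $n_D\in|D|^+$,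 $p_D\in|D|^-$.
   Context: A graph $X$ (directed multigraph) consists of nodes $|X|$, edges $\vec X$, and source and target functions; $\vec X(n,p)$ is the set of edges from $n$ to $p$; morphisms preserve source and target. A polarization $X^{\mathrm{pol}}$ of $X$ is a triple $(|X|^+,|X|^-,\vec X^\star)$ with $|X|^+,|X|^-\subseteq|X|$ and $\vec X^\star\subseteq\vec X$ such that each edge in $\vec X^\star$ has source in $|X|^+$ and target in $|X|^-$. A polarized graph $\mathbf{X}=(X,X^{\mathrm{pol}})$ is a graph with a polarization. A morphism of polarized graphs is a graph morphism $f$ with $f(|X|^+)\subseteq|Y|^+$, $f(|X|^-)\subseteq|Y|^-$, $f(\vec X^\star)\subseteq\vec Y^\star$; this gives the category $\mathbf{Gr}^{\mathrm{pol}}$. A matching of polarized graphs is a monomorphism $f:\mathbf{X}\to\mathbf{Y}$ with $f(X^{\mathrm{pol}})=f(X)\cap Y^{\mathrm{pol}}$ componentwise. The sum $\mathbf{X}_1+\mathbf{X}_2$ is the disjoint union (of graphs and of the three polarization sets). For polarized graphs $\mathbf{X},\mathbf{E}$ with $|E|\subseteq|X|$, $|E|^\pm\subseteq|X|^\pm$, the edge-sum $\mathbf{X}+_e\mathbf{E}$ has nodes $|X|$ with polarizations $|X|^+,|X|^-$, edges $\vec X+\vec E$ and polarized edges $\vec X^\star+\vec E^\star$. Sums/edge-sums of morphisms are defined piecewise. For a subgraph $X$ of a graph $Y$: $\overline X$ is the subgraph generated by the nodes of $Y$ not in $X$ (with all edges of $Y$ between them), $\widetilde X$ the subgraph generated by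 the edges of $Y$ neither in $X$ nor in $\overline X$. If $\mathbf{X}\subseteq\mathbf{Y}$ is a matching, $\overline{\mathbf{X}}=(\overline X,\overline X\cap Y^{\mathrm{pol}})$, $\widetilde{\mathbf{X}}=(\widetilde X,\widetilde X\cap Y^{\mathrm{pol}})$, and $\mathbf{Y}=(\mathbf{X}+\overline{\mathbf{X}})+_e\widetilde{\mathbf{X}}$; the edges of $\widetilde X$ are the linking edges for the matching. A pullback complement of $\mathbf{G}\xleftarrow{m}\mathbf{L}\xleftarrow{l}\mathbf{K}$ is $\mathbf{G}\xleftarrow{l_1}\mathbf{D}\xleftarrow{d}\mathbf{K}$ such that $\mathbf{L}\xleftarrow{l}\mathbf{K}\xrightarrow{d}\mathbf{D}$ is a pullback of $\mathbf{L}\xrightarrow{m}\mathbf{G}\xleftarrow{l_1}\mathbf{D}$ in $\mathbf{Gr}^{\mathrm{pol}}$ (for $m$ a matching, $d$ is then a matching). Such a pullback is called a polarized pullback when every linking edge for $m$ is polarized and every linking edge for $d$ is polarized. When every linking edge for $m$ is polarized, the polarized pushback of $l$ and $m$ is the terminal polarized pullback complement: a polarized pullback complement $\mathbf{G}\xleftarrow{l_1}\mathbf{D}\xleftarrow{d}\mathbf{K}$ such that for every polarized pullback complement $\mathbf{G}\xleftarrow{l_1'}\mathbf{D}'\xleftarrow{d'}\mathbf{K}$ there is a unique morphism $\delta:\mathbf{D}'\to\mathbf{D}$ with $\delta\circ d'=d$ and $l_1\circ\delta=l_1'$. -}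

module Defs where

open import Data.Product using (Σ; Σ-syntax; ∃; _×_; _,_; proj₁; proj₂)
open import Data.Sum using (_⊎_; inj₁; inj₂)
import Data.Sum as Sum
open import Data.Unit using (⊤; tt)
open import Function using (id)
open import Function.Bundles using (_↔_)
open import Relation.Nullary using (¬_)
open import Relation.Binary.PropositionalEquality using (_≡_; refl; trans; cong; sym)

-- Subsets are represented by proposition-valued predicates.

IsProp : Set → Set
IsProp A = (x y : A) → x ≡ y

-- Polarized graphs: a directed multigraph (nodes, edges, source, target)
-- with a polarization (|X|⁺, |X|⁻, X⃗★) given as predicates, such that
-- every polarized edge has positive source and negative target.

record PGraph : Set₁ where
  field
    Node      : Set
    Edge      : Set
    src       : Edge → Node
    tgt       : Edge → Node
    Pos       : Node → Set
    Neg       : Node → Set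
    Star      : Edge → Set
    Pos-prop  : ∀ n → IsProp (Pos n)
    Neg-prop  : ∀ n → IsProp (Neg n)
    Star-prop : ∀ e → IsProp (Star e)
    star-src  : ∀ e → Star e → Pos (src e)
    star-tgt  : ∀ e → Star e → Neg (tgt e)
open PGraph public

record Hom (X Y : PGraph) : Set where
  field
    node      : Node X → Node Y
    edge      : Edge X → Edge Y
    src-pres  : ∀ e → src Y (edge e) ≡ node (src X e)
    tgt-pres  : ∀ e → tgt Y (edge e) ≡ node (tgt X e)
    pos-pres  : ∀ n → Pos X n → Pos Y (node n)
    neg-pres  : ∀ n → Neg X n → Neg Y (node n)
    star-pres : ∀ e → Star X e → Star Y (edge e)
open Hom public

_≈_ : {X Y : PGraph} → Hom X Y → Hom X Y → Set
f ≈ g = (∀ n → node f n ≡ node g n) × (∀ e → edge f e ≡ edge g e)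
infix 4 _≈_

idH : (X : PGraph) → Hom X X
idH X = record
  { node = id ; edge = id
  ; src-pres = λ _ → refl ; tgt-pres = λ _ → refl
  ; pos-pres = λ _ p → p ; neg-pres = λ _ p → p ; star-pres = λ _ p → p }

_∘H_ : {X Y Z : PGraph} → Hom Y Z → Hom X Y → Hom X Z
_∘H_ {X} {Y} {Z} g f = record
  { node = λ n → node g (node f n)
  ; edge = λ e → edge g (edge f e)
  ; src-pres = λ e → trans (src-pres g (edge f e)) (cong (node g) (src-pres f e))
  ; tgt-pres = λ e → trans (tgt-pres g (edge f e)) (cong (node g) (tgt-pres f e))
  ; pos-pres = λ n p → pos-pres g _ (pos-pres f n p)
  ; neg-pres = λ n p → neg-pres g _ (neg-pres f n p)
  ; star-pres = λ e p → star-pres g _ (star-pres f e p) }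
infixr 9 _∘H_

IsMono : {X Y : PGraph} → Hom X Y → Set₁
IsMono {X} {Y} f = (Q : PGraph) (g h : Hom Q X) → f ∘H g ≈ f ∘H h → g ≈ h

-- f(X^pol) = f(X) ∩ Y^pol componentwise (the inclusion ⊆ is automatic
-- for a morphism; we require the reverse inclusion).
IsMatching : {X Y : PGraph} → Hom X Y → Set₁
IsMatching {X} {Y} f =
  IsMono f
  × (∀ n → Pos Y (node f n) → Σ[ n' ∈ Node X ] (node f n' ≡ node f n × Pos X n'))
  × (∀ n → Neg Y (node f n) → Σ[ n' ∈ Node X ] (node f n' ≡ node f n × Neg X n'))
  × (∀ e → Star Y (edge f e) → Σ[ e' ∈ Edge X ] (edge f e' ≡ edge f e × Star X e'))

-- For a (matching) f : X → Y, regarded as a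
-- subgraph f(X) of Y, an edge of Y is a linking edge when it is neither
-- in f(X) nor in the complement subgraph \overline{f(X)} (the subgraph
-- generated by the nodes not in f(X), with all edges between them).

InNodeIm : {X Y : PGraph} → Hom X Y → Node Y → Set
InNodeIm {X} f y = Σ[ x ∈ Node X ] node f x ≡ y

InEdgeIm : {X Y : PGraph} → Hom X Y → Edge Y → Set
InEdgeIm {X} f e = Σ[ x ∈ Edge X ] edge f x ≡ e

InComplement : {X Y : PGraph} → Hom X Y → Edge Y → Set
InComplement {X} {Y} f e = ¬ InNodeIm f (src Y e) × ¬ InNodeIm f (tgt Y e)

Linking : {X Y : PGraph} → Hom X Y → Edge Y → Set
Linking f e = ¬ InEdgeIm f e × ¬ InComplement f e

IsPullback : {K L D G : PGraph} →
             Hom K L → Hom K D → Hom L G → Hom D G → Set₁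
IsPullback {K} {L} {D} {G} l d m l1 =
  (m ∘H l ≈ l1 ∘H d)
  × ((Q : PGraph) (a : Hom Q L) (b : Hom Q D) → m ∘H a ≈ l1 ∘H b →
       Σ[ u ∈ Hom Q K ] ((l ∘H u ≈ a × d ∘H u ≈ b)
         × ((u' : Hom Q K) → l ∘H u' ≈ a → d ∘H u' ≈ b → u' ≈ u)))

IsPBC : {K L G D : PGraph} → Hom K L → Hom L G → Hom D G → Hom K D → Set₁
IsPBC l m l1 d = IsPullback l d m l1

IsPolPBC : {K L G D : PGraph} → Hom K L → Hom L G → Hom D G → Hom K D → Set₁
IsPolPBC {K} {L} {G} {D} l m l1 d =
  IsPBC l m l1 d
  × (∀ e → Linking m e → Star G e)
  × (∀ e → Linking d e → Star D e)

IsPolPushback : {K L G D : PGraph} → Hom K L → Hom L G → Hom D G → Hom K D → Set₁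
IsPolPushback {K} {L} {G} {D} l m l1 d =
  IsPolPBC l m l1 d
  × ((D' : PGraph) (l1' : Hom D' G) (d' : Hom K D') → IsPolPBC l m l1' d' →
       Σ[ δ ∈ Hom D' D ] ((δ ∘H d' ≈ d × l1 ∘H δ ≈ l1')
         × ((δ' : Hom D' D) → δ' ∘H d' ≈ d → l1 ∘H δ' ≈ l1' → δ' ≈ δ)))

_⊕_ : PGraph → PGraph → PGraph
X ⊕ Y = record
  { Node = Node X ⊎ Node Y
  ; Edge = Edge X ⊎ Edge Y
  ; src = Sum.map (src X) (src Y)
  ; tgt = Sum.map (tgt X) (tgt Y)
  ; Pos = Sum.[ Pos X , Pos Y ]
  ; Neg = Sum.[ Neg X , Neg Y ]
  ; Star = Sum.[ Star X , Star Y ]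
  ; Pos-prop = λ { (inj₁ n) → Pos-prop X n ; (inj₂ n) → Pos-prop Y n }
  ; Neg-prop = λ { (inj₁ n) → Neg-prop X n ; (inj₂ n) → Neg-prop Y n }
  ; Star-prop = λ { (inj₁ e) → Star-prop X e ; (inj₂ e) → Star-prop Y e }
  ; star-src = λ { (inj₁ e) p → star-src X e p ; (inj₂ e) p → star-src Y e p }
  ; star-tgt = λ { (inj₁ e) p → star-tgt X e p ; (inj₂ e) p → star-tgt Y e p }
  }
infixl 6 _⊕_

_⊕H_ : {X₁ Y₁ X₂ Y₂ : PGraph} → Hom X₁ Y₁ → Hom X₂ Y₂ → Hom (X₁ ⊕ X₂) (Y₁ ⊕ Y₂)
f ⊕H g = record
  { node = Sum.map (node f) (node g)
  ; edge = Sum.map (edge f) (edge g)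
  ; src-pres = λ { (inj₁ e) → cong inj₁ (src-pres f e) ; (inj₂ e) → cong inj₂ (src-pres g e) }
  ; tgt-pres = λ { (inj₁ e) → cong inj₁ (tgt-pres f e) ; (inj₂ e) → cong inj₂ (tgt-pres g e) }
  ; pos-pres = λ { (inj₁ n) p → pos-pres f n p ; (inj₂ n) p → pos-pres g n p }
  ; neg-pres = λ { (inj₁ n) p → neg-pres f n p ; (inj₂ n) p → neg-pres g n p }
  ; star-pres = λ { (inj₁ e) p → star-pres f e p ; (inj₂ e) p → star-pres g e p }
  }

ι₁ : (X Y : PGraph) → Hom X (X ⊕ Y)
ι₁ X Y = record
  { node = inj₁ ; edge = inj₁
  ; src-pres = λ _ → refl ; tgt-pres = λ _ → refl
  ; pos-pres = λ _ p → p ; neg-pres = λ _ p → p ; star-pres = λ _ p → p }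

-- A polarized graph E with |E| ⊆ |X| and |E|^± ⊆ |X|^± is
-- given by its edges, with source/target in |X| and a set of polarized
-- edges, each having positive source and negative target in X.

record EdgeBundle (X : PGraph) : Set₁ where
  field
    EEdge      : Set
    esrc       : EEdge → Node X
    etgt       : EEdge → Node X
    EStar      : EEdge → Set
    EStar-prop : ∀ e → IsProp (EStar e)
    estar-src  : ∀ e → EStar e → Pos X (esrc e)
    estar-tgt  : ∀ e → EStar e → Neg X (etgt e)
open EdgeBundle public

_+e_ : (X : PGraph) → EdgeBundle X → PGraph
X +e E = record
  { Node = Node X
  ; Edge = Edge X ⊎ EEdge E
  ; src = Sum.[ src X , esrc E ]
  ; tgt = Sum.[ tgt X , etgt E ]
  ; Pos = Pos X
  ; Neg = Neg X
  ; Star = Sum.[ Star X , EStar E ]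
  ; Pos-prop = Pos-prop X
  ; Neg-prop = Neg-prop X
  ; Star-prop = λ { (inj₁ e) → Star-prop X e ; (inj₂ e) → EStar-prop E e }
  ; star-src = λ { (inj₁ e) p → star-src X e p ; (inj₂ e) p → estar-src E e p }
  ; star-tgt = λ { (inj₁ e) p → star-tgt X e p ; (inj₂ e) p → estar-tgt E e p }
  }
infixl 5 _+e_

record BundleHom {X Y : PGraph} (f : Hom X Y) (E : EdgeBundle X) (F : EdgeBundle Y) : Set where
  field
    bedge      : EEdge E → EEdge F
    bsrc-pres  : ∀ e → esrc F (bedge e) ≡ node f (esrc E e)
    btgt-pres  : ∀ e → etgt F (bedge e) ≡ node f (etgt E e)
    bstar-pres : ∀ e → EStar E e → EStar F (bedge e)
open BundleHom public

_+eH_ : {X Y : PGraph} {E : EdgeBundle X} {F : EdgeBundle Y} →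
        (f : Hom X Y) → BundleHom f E F → Hom (X +e E) (Y +e F)
f +eH g = record
  { node = node f
  ; edge = Sum.map (edge f) (bedge g)
  ; src-pres = λ { (inj₁ e) → src-pres f e ; (inj₂ e) → bsrc-pres g e }
  ; tgt-pres = λ { (inj₁ e) → tgt-pres f e ; (inj₂ e) → btgt-pres g e }
  ; pos-pres = pos-pres f
  ; neg-pres = neg-pres f
  ; star-pres = λ { (inj₁ e) p → star-pres f e p ; (inj₂ e) p → bstar-pres g e p }
  }

ιe : (X : PGraph) (E : EdgeBundle X) → Hom X (X +e E)
ιe X E = record
  { node = id ; edge = inj₁
  ; src-pres = λ _ → refl ; tgt-pres = λ _ → refl
  ; pos-pres = λ _ p → p ; neg-pres = λ _ p → p ; star-pres = λ _ p → p }

module Construction (K L Lbar : PGraph) (Lt : EdgeBundle (L ⊕ Lbar)) (l : Hom K L) where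

  G : PGraph
  G = L ⊕ Lbar +e Lt

  m : Hom L G
  m = ιe (L ⊕ Lbar) Lt ∘H ι₁ L Lbar

  D₀ : PGraph
  D₀ = K ⊕ Lbar

  l₀ : Hom D₀ (L ⊕ Lbar)
  l₀ = l ⊕H idH Lbar

  l1n : Node D₀ → Node (L ⊕ Lbar)
  l1n = node l₀

  record KtEdge : Set where
    constructor ktedge
    field
      ke   : EEdge Lt
      knD  : Node D₀
      kpD  : Node D₀
      kpos : Pos D₀ knD
      kneg : Neg D₀ kpD
      kstar : EStar Lt ke
      ksrc : esrc Lt ke ≡ l1n knD
      ktgt : etgt Lt ke ≡ l1n kpD

  Kt : EdgeBundle D₀
  Kt = record
    { EEdge = KtEdge
    ; esrc = KtEdge.knD
    ; etgt = KtEdge.kpD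
    ; EStar = λ _ → ⊤
    ; EStar-prop = λ _ _ _ → refl
    ; estar-src = λ t _ → KtEdge.kpos t
    ; estar-tgt = λ t _ → KtEdge.kneg t
    }

  D : PGraph
  D = D₀ +e Kt

  d : Hom K D
  d = ιe D₀ Kt ∘H ι₁ K Lbar

  lt : BundleHom l₀ Kt Lt
  lt = record
    { bedge = KtEdge.ke
    ; bsrc-pres = KtEdge.ksrc
    ; btgt-pres = KtEdge.ktgt
    ; bstar-pres = λ t _ → KtEdge.kstar t
    }

  l1 : Hom D G
  l1 = l₀ +eH lt

  EdgesBetween : {X : PGraph} (E : EdgeBundle X) → Node X → Node X → Set
  EdgesBetween E n p = Σ[ e ∈ EEdge E ] (esrc E e ≡ n × etgt E e ≡ p)

  StarEdgesBetween : {X : PGraph} (E : EdgeBundle X) → Node X → Node X → Set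
  StarEdgesBetween E n p = Σ[ e ∈ EEdge E ] (EStar E e × esrc E e ≡ n × etgt E e ≡ p)

IsLeft : {A B : Set} → A ⊎ B → Set
IsLeft {A} x = Σ[ a ∈ A ] x ≡ inj₁ a

module Submission where

-- Terminality: for another
-- polarized pullback complement D', δ : D' → D goes through K over L (via
-- the pullback D'), is the identity over L̄, and sends an edge over L̃ to a
-- K̃-edge (such an edge is linking for d', hence polarized).

open import Defs
open import Data.Product using (Σ-syntax; _×_; _,_; proj₁; proj₂)
open import Data.Sum using (_⊎_; inj₁; inj₂)
open import Data.Sum.Properties using (inj₁-injective; inj₂-injective)
open import Data.Unit using (tt)
open import Data.Empty using (⊥-elim)
open import Relation.Nullary using (¬_)
open import Function.Bundles using (_↔_; mk↔ₛ′)
open import Relation.Binary.PropositionalEquality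
  using (_≡_; refl; sym; trans; cong; subst; trans-reflʳ)
open import Axiom.UniquenessOfIdentityProofs.WithK using (uip)

-- An endomorphism of the corner of a pullback that commutes with both legs
-- is the identity (both it and the identity are the mediating morphism of
-- the cone (l, d) itself).
pullback-endo-id : {K L D G : PGraph} {l : Hom K L} {d : Hom K D} {m : Hom L G} {l1 : Hom D G} →
  IsPullback l d m l1 → (v : Hom K K) → l ∘H v ≈ l → d ∘H v ≈ d → v ≈ idH K
pullback-endo-id {K} {l = l} {d} (square , universal) v lv dv =
  (λ k → trans (proj₁ v≈u k) (sym (proj₁ id≈u k))) , (λ e → trans (proj₂ v≈u e) (sym (proj₂ id≈u e)))
  where
  unique : (u' : Hom K K) → l ∘H u' ≈ l → d ∘H u' ≈ d → u' ≈ proj₁ (universal K l d square)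
  unique = proj₂ (proj₂ (universal K l d square))
  v≈u : v ≈ proj₁ (universal K l d square)
  v≈u = unique v lv dv
  id≈u : idH K ≈ proj₁ (universal K l d square)
  id≈u = unique (idH K) ((λ _ → refl) , (λ _ → refl)) ((λ _ → refl) , (λ _ → refl))

-- The canonical inclusion of A into (A + B) +e E; both m and d are of this form.
leftInclusion : (A B : PGraph) (E : EdgeBundle (A ⊕ B)) → Hom A ((A ⊕ B) +e E)
leftInclusion A B E = ιe (A ⊕ B) E ∘H ι₁ A B

-- The linking edges of the inclusion are exactly edges of E: edges of A are
-- in its image, edges of B join nodes outside it.
linking-in-bundle : {A B : PGraph} {E : EdgeBundle (A ⊕ B)} (e : Edge ((A ⊕ B) +e E)) →
  Linking (leftInclusion A B E) e → Σ[ t ∈ EEdge E ] e ≡ inj₂ t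
linking-in-bundle (inj₁ (inj₁ a)) (notImage , _) = ⊥-elim (notImage (a , refl))
linking-in-bundle (inj₁ (inj₂ b)) (_ , notComplement) =
  ⊥-elim (notComplement ((λ { (_ , ()) }) , (λ { (_ , ()) })))
linking-in-bundle (inj₂ t) _ = t , refl

linking-polarized : {A B : PGraph} {E : EdgeBundle (A ⊕ B)} → (∀ t → EStar E t) →
  ∀ e → Linking (leftInclusion A B E) e → Star ((A ⊕ B) +e E) e
linking-polarized {A} {B} {E} allStar e link with linking-in-bundle {A} {B} {E} e link
... | t , refl = allStar t

-- The part of X lying over A, for f : X → (A + B) +e E: the pullback of the
-- inclusion of A along f.
module Over {A B : PGraph} {E : EdgeBundle (A ⊕ B)} {X : PGraph} (f : Hom X ((A ⊕ B) +e E)) where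

  OverNode : Set
  OverNode = Σ[ x ∈ Node X ] Σ[ a ∈ Node A ] node f x ≡ inj₁ a

  OverEdge : Set
  OverEdge = Σ[ e ∈ Edge X ] Σ[ a ∈ Edge A ] edge f e ≡ inj₁ (inj₁ a)

  overNode-≡ : {x x' : Node X} {a a' : Node A} (p : node f x ≡ inj₁ a) (p' : node f x' ≡ inj₁ a') →
               x ≡ x' → a ≡ a' → _≡_ {A = OverNode} (x , a , p) (x' , a' , p')
  overNode-≡ p p' refl refl = cong (λ r → _ , _ , r) (uip p p')

  overEdge-≡ : {e e' : Edge X} {a a' : Edge A} (p : edge f e ≡ inj₁ (inj₁ a)) (p' : edge f e' ≡ inj₁ (inj₁ a')) →
               e ≡ e' → a ≡ a' → _≡_ {A = OverEdge} (e , a , p) (e' , a' , p')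
  overEdge-≡ p p' refl refl = cong (λ r → _ , _ , r) (uip p p')

  Over : PGraph
  Over = record
    { Node = OverNode ; Edge = OverEdge
    ; src = λ { (e , a , p) → src X e , src A a
                  , trans (sym (src-pres f e)) (cong (src ((A ⊕ B) +e E)) p) }
    ; tgt = λ { (e , a , p) → tgt X e , tgt A a
                  , trans (sym (tgt-pres f e)) (cong (tgt ((A ⊕ B) +e E)) p) }
    ; Pos = λ q → Pos X (proj₁ q) ; Neg = λ q → Neg X (proj₁ q) ; Star = λ q → Star X (proj₁ q)
    ; Pos-prop = λ q → Pos-prop X (proj₁ q) ; Neg-prop = λ q → Neg-prop X (proj₁ q)
    ; Star-prop = λ q → Star-prop X (proj₁ q)
    ; star-src = λ q → star-src X (proj₁ q) ; star-tgt = λ q → star-tgt X (proj₁ q) }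

  toA : Hom Over A
  toA = record
    { node = λ q → proj₁ (proj₂ q) ; edge = λ q → proj₁ (proj₂ q)
    ; src-pres = λ _ → refl ; tgt-pres = λ _ → refl
    ; pos-pres = λ { (x , _ , p) pos → subst (Pos ((A ⊕ B) +e E)) p (pos-pres f x pos) }
    ; neg-pres = λ { (x , _ , p) neg → subst (Neg ((A ⊕ B) +e E)) p (neg-pres f x neg) }
    ; star-pres = λ { (e , _ , p) s → subst (Star ((A ⊕ B) +e E)) p (star-pres f e s) } }

  toX : Hom Over X
  toX = record
    { node = proj₁ ; edge = proj₁
    ; src-pres = λ _ → refl ; tgt-pres = λ _ → refl
    ; pos-pres = λ _ p → p ; neg-pres = λ _ p → p ; star-pres = λ _ p → p }

  over-commutes : leftInclusion A B E ∘H toA ≈ f ∘H toX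
  over-commutes = (λ q → sym (proj₂ (proj₂ q))) , (λ q → sym (proj₂ (proj₂ q)))

  factor : (Q : PGraph) (a : Hom Q A) (b : Hom Q X) → leftInclusion A B E ∘H a ≈ f ∘H b → Hom Q Over
  factor Q a b (cn , ce) = record
    { node = λ q → node b q , node a q , sym (cn q)
    ; edge = λ e → edge b e , edge a e , sym (ce e)
    ; src-pres = λ e → overNode-≡ _ _ (src-pres b e) (src-pres a e)
    ; tgt-pres = λ e → overNode-≡ _ _ (tgt-pres b e) (tgt-pres a e)
    ; pos-pres = pos-pres b ; neg-pres = neg-pres b ; star-pres = star-pres b }

module Proof (K L Lbar : PGraph) (Lt : EdgeBundle (L ⊕ Lbar)) (l : Hom K L)
  (linking : ∀ e → IsLeft (esrc Lt e) ⊎ IsLeft (etgt Lt e))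
  (allStar : ∀ e → EStar Lt e) where

  open Construction K L Lbar Lt l

  node-over-L : (z : Node D) {y : Node L} → inj₁ y ≡ l1n z →
                Σ[ k ∈ Node K ] (inj₁ k ≡ z × node l k ≡ y)
  node-over-L (inj₁ k) refl = k , refl , refl
  node-over-L (inj₂ _) ()

  edge-over-L : (z : Edge D) {y : Edge L} → inj₁ (inj₁ y) ≡ edge l1 z →
                Σ[ k ∈ Edge K ] (inj₁ (inj₁ k) ≡ z × edge l k ≡ y)
  edge-over-L (inj₁ (inj₁ k)) refl = k , refl , refl
  edge-over-L (inj₁ (inj₂ _)) ()
  edge-over-L (inj₂ _) ()

  isPullback : IsPullback l d m l1
  isPullback = ((λ _ → refl) , (λ _ → refl)) , universal
    where
    universal : (Q : PGraph) (a : Hom Q L) (b : Hom Q D) → m ∘H a ≈ l1 ∘H b →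
      Σ[ u ∈ Hom Q K ] ((l ∘H u ≈ a × d ∘H u ≈ b)
        × ((u' : Hom Q K) → l ∘H u' ≈ a → d ∘H u' ≈ b → u' ≈ u))
    universal Q a b (cn , ce) = u , (lu , du) , unique
      where
      nodeK : ∀ q → Σ[ k ∈ Node K ] (inj₁ k ≡ node b q × node l k ≡ node a q)
      nodeK q = node-over-L (node b q) (cn q)
      edgeK : ∀ e → Σ[ k ∈ Edge K ] (inj₁ (inj₁ k) ≡ edge b e × edge l k ≡ edge a e)
      edgeK e = edge-over-L (edge b e) (ce e)
      u : Hom Q K
      u = record
        { node = λ q → proj₁ (nodeK q) ; edge = λ e → proj₁ (edgeK e)
        ; src-pres = λ e → inj₁-injective (trans (cong (src D) (proj₁ (proj₂ (edgeK e))))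
                             (trans (src-pres b e) (sym (proj₁ (proj₂ (nodeK (src Q e)))))))
        ; tgt-pres = λ e → inj₁-injective (trans (cong (tgt D) (proj₁ (proj₂ (edgeK e))))
                             (trans (tgt-pres b e) (sym (proj₁ (proj₂ (nodeK (tgt Q e)))))))
        ; pos-pres = λ q p → subst (Pos D) (sym (proj₁ (proj₂ (nodeK q)))) (pos-pres b q p)
        ; neg-pres = λ q p → subst (Neg D) (sym (proj₁ (proj₂ (nodeK q)))) (neg-pres b q p)
        ; star-pres = λ e p → subst (Star D) (sym (proj₁ (proj₂ (edgeK e)))) (star-pres b e p) }
      lu : l ∘H u ≈ a
      lu = (λ q → proj₂ (proj₂ (nodeK q))) , (λ e → proj₂ (proj₂ (edgeK e)))
      du : d ∘H u ≈ b
      du = (λ q → proj₁ (proj₂ (nodeK q))) , (λ e → proj₁ (proj₂ (edgeK e)))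
      unique : (u' : Hom Q K) → l ∘H u' ≈ a → d ∘H u' ≈ b → u' ≈ u
      unique u' _ du' = (λ q → inj₁-injective (trans (proj₁ du' q) (sym (proj₁ du q))))
                      , (λ e → inj₁-injective (inj₁-injective (trans (proj₂ du' e) (sym (proj₂ du e)))))

  isPolPBC : IsPolPBC l m l1 d
  isPolPBC = isPullback , linking-polarized {L} {Lbar} {Lt} allStar
                            , linking-polarized {K} {Lbar} {Kt} (λ _ → tt)

  -- A K̃-edge is determined by its L̃-edge and its end points, the other
  -- fields being proofs of propositions.
  ktedge-≡ : (t t' : KtEdge) → KtEdge.ke t ≡ KtEdge.ke t' →
             KtEdge.knD t ≡ KtEdge.knD t' → KtEdge.kpD t ≡ KtEdge.kpD t' → t ≡ t'
  ktedge-≡ (ktedge e n p pos neg s sp tp) (ktedge .e .n .p pos' neg' s' sp' tp') refl refl refl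
    with Pos-prop D₀ n pos pos' | Neg-prop D₀ p neg neg' | EStar-prop Lt e s s' | uip sp sp' | uip tp tp'
  ... | refl | refl | refl | refl | refl = refl

  edges-are-star : ∀ nD pD → EdgesBetween Kt nD pD ↔ StarEdgesBetween Kt nD pD
  edges-are-star nD pD = mk↔ₛ′ (λ { (t , p , q) → t , tt , p , q }) (λ { (t , _ , p , q) → t , p , q })
                               (λ _ → refl) (λ _ → refl)

  star-edges-correspond : ∀ nD pD → Pos D nD → Neg D pD →
    StarEdgesBetween Kt nD pD ↔ StarEdgesBetween Lt (l1n nD) (l1n pD)
  star-edges-correspond nD pD pos neg = mk↔ₛ′ to from to-from from-to
    where
    to : StarEdgesBetween Kt nD pD → StarEdgesBetween Lt (l1n nD) (l1n pD)
    to (t , _ , p , q) = KtEdge.ke t , KtEdge.kstar t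
                       , trans (KtEdge.ksrc t) (cong l1n p) , trans (KtEdge.ktgt t) (cong l1n q)
    from : StarEdgesBetween Lt (l1n nD) (l1n pD) → StarEdgesBetween Kt nD pD
    from (e , s , p , q) = ktedge e nD pD pos neg s p q , tt , refl , refl
    to-from : ∀ y → to (from y) ≡ y
    to-from (e , s , p , q) rewrite trans-reflʳ p | trans-reflʳ q = refl
    from-to : ∀ x → from (to x) ≡ x
    from-to (t , tt , p , q) = star-edge-≡ _ _ p q (ktedge-≡ _ t refl (sym p) (sym q))
      where
      star-edge-≡ : {t t' : KtEdge} (p : KtEdge.knD t ≡ nD) (q : KtEdge.kpD t ≡ pD)
                    (p' : KtEdge.knD t' ≡ nD) (q' : KtEdge.kpD t' ≡ pD) →
                    t ≡ t' → _≡_ {A = StarEdgesBetween Kt nD pD} (t , tt , p , q) (t' , tt , p' , q')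
      star-edge-≡ p q p' q' refl rewrite uip p p' | uip q q' = refl

  module Terminal (D' : PGraph) (l1' : Hom D' G) (d' : Hom K D') (pbc : IsPolPBC l m l1' d') where

    open Over l1'

    pullback' : IsPullback l d' m l1'
    pullback' = proj₁ pbc

    overK : Σ[ u ∈ Hom Over K ] ((l ∘H u ≈ toA × d' ∘H u ≈ toX)
              × ((u' : Hom Over K) → l ∘H u' ≈ toA → d' ∘H u' ≈ toX → u' ≈ u))
    overK = proj₂ pullback' Over toA toX over-commutes

    u : Hom Over K
    u = proj₁ overK

    lu : l ∘H u ≈ toA
    lu = proj₁ (proj₁ (proj₂ overK))

    d'u : d' ∘H u ≈ toX
    d'u = proj₂ (proj₁ (proj₂ overK))

    inclK : Hom K Over
    inclK = factor K l d' (proj₁ pullback')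

    u-inclK : u ∘H inclK ≈ idH K
    u-inclK = pullback-endo-id {K} {L} {D'} {G} {l} {d'} {m} {l1'} pullback' (u ∘H inclK)
      ((λ k → proj₁ lu (node inclK k)) , (λ e → proj₂ lu (edge inclK e)))
      ((λ k → proj₁ d'u (node inclK k)) , (λ e → proj₂ d'u (edge inclK e)))

    -- An edge of D' sent into L̃ is a linking edge of d' (it is not in d'(K)
    -- since l₁' ∘ d' lands in L, and one of its ends lies over L, hence in
    -- d'(K)); so it is polarized.
    over-Lt-polarized : ∀ e t → edge l1' e ≡ inj₂ t → Star D' e
    over-Lt-polarized e t q = proj₂ (proj₂ pbc) e (notImage , notComplement)
      where
      notImage : ¬ InEdgeIm d' e
      notImage (k , r) with trans (proj₂ (proj₁ pullback') k) (trans (cong (edge l1') r) q)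
      ... | ()
      notComplement : ¬ InComplement d' e
      notComplement (notSrc , notTgt) with linking t
      ... | inj₁ (a , r) = notSrc (node u w , proj₁ d'u w)
        where w : OverNode
              w = src D' e , a , trans (sym (src-pres l1' e)) (trans (cong (src G) q) r)
      ... | inj₂ (a , r) = notTgt (node u w , proj₁ d'u w)
        where w : OverNode
              w = tgt D' e , a , trans (sym (tgt-pres l1' e)) (trans (cong (tgt G) q) r)

    δnode' : (x : Node D') (y : Node G) → node l1' x ≡ y → Node D
    δnode' x (inj₁ a) q = inj₁ (node u (x , a , q))
    δnode' x (inj₂ b) q = inj₂ b

    δnode : Node D' → Node D
    δnode x = δnode' x (node l1' x) refl

    δnode-over-L : ∀ x a (p : node l1' x ≡ inj₁ a) → δnode x ≡ inj₁ (node u (x , a , p))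
    δnode-over-L x a p = go (node l1' x) refl
      where
      go : ∀ y (q : node l1' x ≡ y) → δnode' x y q ≡ inj₁ (node u (x , a , p))
      go (inj₁ a') q = cong (λ w → inj₁ (node u w)) (overNode-≡ q p refl (inj₁-injective (trans (sym q) p)))
      go (inj₂ b) q with trans (sym q) p
      ... | ()

    δnode-over-Lbar : ∀ x b → node l1' x ≡ inj₂ b → δnode x ≡ inj₂ b
    δnode-over-Lbar x b p = go (node l1' x) refl
      where
      go : ∀ y (q : node l1' x ≡ y) → δnode' x y q ≡ inj₂ b
      go (inj₁ a) q with trans (sym q) p
      ... | ()
      go (inj₂ b') q = cong inj₂ (inj₂-injective (trans (sym q) p))

    δnode'-l1 : ∀ x y q → l1n (δnode' x y q) ≡ node l1' x
    δnode'-l1 x (inj₁ a) q = trans (cong inj₁ (proj₁ lu (x , a , q))) (sym q)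
    δnode'-l1 x (inj₂ b) q = sym q

    δnode'-pos : ∀ x y q → Pos D' x → Pos D (δnode' x y q)
    δnode'-pos x (inj₁ a) q p = pos-pres u (x , a , q) p
    δnode'-pos x (inj₂ b) q p = subst (Pos G) q (pos-pres l1' x p)

    δnode'-neg : ∀ x y q → Neg D' x → Neg D (δnode' x y q)
    δnode'-neg x (inj₁ a) q p = neg-pres u (x , a , q) p
    δnode'-neg x (inj₂ b) q p = subst (Neg G) q (neg-pres l1' x p)

    δedge' : (e : Edge D') (y : Edge G) → edge l1' e ≡ y → Edge D
    δedge' e (inj₁ (inj₁ a)) q = inj₁ (inj₁ (edge u (e , a , q)))
    δedge' e (inj₁ (inj₂ b)) q = inj₁ (inj₂ b)
    δedge' e (inj₂ t) q = inj₂ (ktedge t (δnode (src D' e)) (δnode (tgt D' e))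
        (δnode'-pos (src D' e) _ refl (star-src D' e (over-Lt-polarized e t q)))
        (δnode'-neg (tgt D' e) _ refl (star-tgt D' e (over-Lt-polarized e t q)))
        (allStar t)
        (trans (cong (src G) (sym q)) (trans (src-pres l1' e) (sym (δnode'-l1 (src D' e) _ refl))))
        (trans (cong (tgt G) (sym q)) (trans (tgt-pres l1' e) (sym (δnode'-l1 (tgt D' e) _ refl)))))

    δedge'-src : ∀ e y q → src D (δedge' e y q) ≡ δnode (src D' e)
    δedge'-src e (inj₁ (inj₁ a)) q = trans (cong inj₁ (src-pres u (e , a , q))) (sym (δnode-over-L _ _ _))
    δedge'-src e (inj₁ (inj₂ b)) q =
      sym (δnode-over-Lbar (src D' e) (src Lbar b) (trans (sym (src-pres l1' e)) (cong (src G) q)))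
    δedge'-src e (inj₂ t) q = refl

    δedge'-tgt : ∀ e y q → tgt D (δedge' e y q) ≡ δnode (tgt D' e)
    δedge'-tgt e (inj₁ (inj₁ a)) q = trans (cong inj₁ (tgt-pres u (e , a , q))) (sym (δnode-over-L _ _ _))
    δedge'-tgt e (inj₁ (inj₂ b)) q =
      sym (δnode-over-Lbar (tgt D' e) (tgt Lbar b) (trans (sym (tgt-pres l1' e)) (cong (tgt G) q)))
    δedge'-tgt e (inj₂ t) q = refl

    δedge'-star : ∀ e y q → Star D' e → Star D (δedge' e y q)
    δedge'-star e (inj₁ (inj₁ a)) q s = star-pres u (e , a , q) s
    δedge'-star e (inj₁ (inj₂ b)) q s = subst (Star G) q (star-pres l1' e s)
    δedge'-star e (inj₂ t) q s = tt

    δedge'-l1 : ∀ e y q → edge l1 (δedge' e y q) ≡ edge l1' e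
    δedge'-l1 e (inj₁ (inj₁ a)) q = trans (cong (λ z → inj₁ (inj₁ z)) (proj₂ lu (e , a , q))) (sym q)
    δedge'-l1 e (inj₁ (inj₂ b)) q = sym q
    δedge'-l1 e (inj₂ t) q = sym q

    δ : Hom D' D
    δ = record
      { node = δnode ; edge = λ e → δedge' e (edge l1' e) refl
      ; src-pres = λ e → δedge'-src e _ refl ; tgt-pres = λ e → δedge'-tgt e _ refl
      ; pos-pres = λ x → δnode'-pos x _ refl
      ; neg-pres = λ x → δnode'-neg x _ refl
      ; star-pres = λ e → δedge'-star e _ refl }

    δedge-over-L : ∀ e a (p : edge l1' e ≡ inj₁ (inj₁ a)) → edge δ e ≡ inj₁ (inj₁ (edge u (e , a , p)))
    δedge-over-L e a p = go (edge l1' e) refl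
      where
      go : ∀ y (q : edge l1' e ≡ y) → δedge' e y q ≡ inj₁ (inj₁ (edge u (e , a , p)))
      go (inj₁ (inj₁ a')) q = cong (λ w → inj₁ (inj₁ (edge u w)))
                                   (overEdge-≡ q p refl (inj₁-injective (inj₁-injective (trans (sym q) p))))
      go (inj₁ (inj₂ b)) q with trans (sym q) p
      ... | ()
      go (inj₂ t) q with trans (sym q) p
      ... | ()

    δ-d' : δ ∘H d' ≈ d
    δ-d' = (λ k → trans (δnode-over-L (node d' k) (node l k) (sym (proj₁ (proj₁ pullback') k)))
                         (cong inj₁ (proj₁ u-inclK k)))
         , (λ k → trans (δedge-over-L (edge d' k) (edge l k) (sym (proj₂ (proj₁ pullback') k)))
                         (cong (λ z → inj₁ (inj₁ z)) (proj₂ u-inclK k)))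

    l1-δ : l1 ∘H δ ≈ l1'
    l1-δ = (λ x → δnode'-l1 x _ refl) , (λ e → δedge'-l1 e _ refl)

    node-over-Lbar : ∀ {b} (z : Node D) → l1n z ≡ inj₂ b → z ≡ inj₂ b
    node-over-Lbar (inj₁ k) ()
    node-over-Lbar (inj₂ b') r = cong inj₂ (inj₂-injective r)

    edge-over-Lbar : ∀ {b} (z : Edge D) → edge l1 z ≡ inj₁ (inj₂ b) → z ≡ inj₁ (inj₂ b)
    edge-over-Lbar (inj₁ (inj₁ k)) ()
    edge-over-Lbar (inj₁ (inj₂ b')) r = cong (λ z → inj₁ (inj₂ z)) (inj₂-injective (inj₁-injective r))
    edge-over-Lbar (inj₂ _) ()

    edge-over-Lt : ∀ (t' : KtEdge) (z : Edge D) → edge l1 z ≡ inj₂ (KtEdge.ke t') →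
                   src D z ≡ KtEdge.knD t' → tgt D z ≡ KtEdge.kpD t' → z ≡ inj₂ t'
    edge-over-Lt t' (inj₁ (inj₁ k)) ()
    edge-over-Lt t' (inj₁ (inj₂ b')) ()
    edge-over-Lt t' (inj₂ t) r s g = cong inj₂ (ktedge-≡ t t' (inj₂-injective r) s g)

    unique : (δ' : Hom D' D) → δ' ∘H d' ≈ d → l1 ∘H δ' ≈ l1' → δ' ≈ δ
    unique δ' δ'd' l1δ' = (λ x → node-unique x _ refl) , (λ e → edge-unique e _ refl)
      where
      node-unique : ∀ x y q → node δ' x ≡ δnode' x y q
      node-unique x (inj₁ a) q = trans (cong (node δ') (sym (proj₁ d'u (x , a , q))))
                                       (proj₁ δ'd' (node u (x , a , q)))
      node-unique x (inj₂ b) q = node-over-Lbar (node δ' x) (trans (proj₁ l1δ' x) q)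
      edge-unique : ∀ e y q → edge δ' e ≡ δedge' e y q
      edge-unique e (inj₁ (inj₁ a)) q = trans (cong (edge δ') (sym (proj₂ d'u (e , a , q))))
                                              (proj₂ δ'd' (edge u (e , a , q)))
      edge-unique e (inj₁ (inj₂ b)) q = edge-over-Lbar (edge δ' e) (trans (proj₂ l1δ' e) q)
      edge-unique e (inj₂ t) q = edge-over-Lt _ (edge δ' e) (trans (proj₂ l1δ' e) q)
        (trans (src-pres δ' e) (node-unique (src D' e) _ refl))
        (trans (tgt-pres δ' e) (node-unique (tgt D' e) _ refl))

  isTerminal : (D' : PGraph) (l1' : Hom D' G) (d' : Hom K D') → IsPolPBC l m l1' d' →
    Σ[ δ ∈ Hom D' D ] ((δ ∘H d' ≈ d × l1 ∘H δ ≈ l1')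
      × ((δ' : Hom D' D) → δ' ∘H d' ≈ d → l1 ∘H δ' ≈ l1' → δ' ≈ δ))
  isTerminal D' l1' d' pbc = δ , (δ-d' , l1-δ) , unique
    where open Terminal D' l1' d' pbc

proposition2p14 : (K L Lbar : PGraph) (Lt : EdgeBundle (L ⊕ Lbar)) (l : Hom K L) →
    let open Construction K L Lbar Lt l in
    (∀ e → IsLeft (esrc Lt e) ⊎ IsLeft (etgt Lt e)) →
    (∀ e → EStar Lt e) →
    IsPolPushback l m l1 d
    × (∀ e → EStar Kt e)
    × (∀ nD pD → Pos D nD → Neg D pD →
    (EdgesBetween Kt nD pD ↔ StarEdgesBetween Kt nD pD)
    × (StarEdgesBetween Kt nD pD ↔ StarEdgesBetween Lt (l1n nD) (l1n pD)))
proposition2p14 K L Lbar Lt l linking allStar =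
  (isPolPBC , isTerminal) , (λ _ → tt)
  , (λ nD pD pos neg → edges-are-star nD pD , star-edges-correspond nD pD pos neg)
  where open Proof K L Lbar Lt l linking allStar
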